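{- Let $C$ be any $(4,1)$ chromotopology on the labeled vertex set $\{b_1,\dots,b_4\}\cup\{f_1,\dots,f_4\}$. Then there is a unique pair $(\rho_B,\rho_F)\in S_4\times S_4$ such that $\rho_F(1)=1$ and $C$ is obtained from the standard chromotopology $C^0$ by applying $\rho_B$ to the bosons and $\rho_F$ to the fermions, i.e. for every color $c$ and all $i,j$, $C$ has an edge of color $c$ between $b_{\rho_B(i)}$ and $f_{\rho_F(j)}$ if and only if $C^0$ has an edge of color $c$ between $b_i$ and $f_j$.
   Context: A $(4,1)$ chromotopology on vertex set $B\cup F$, with bosons $B=\{b_1,\dots,b_4\}$ and fermions $F=\{f_1,\dots,f_4\}$, is the complete bipartite graph $K_{4,4}$ between $B$ and $F$ with edges colored by $\{1,2,3,4\}$ so that every vertex is incident to exactly one edge of each color and, for any two distinct colors, the edges of those two colors form a disjoint union of $4$-cycles. The standard chromotopology $C^0$ has the following edges: color $1$: $b_if_i$ for $i=1,\dots,4$; color $2$: $f_1b_2,\ f_2b_1,\ f_3b_4,\ f_4b_3$; color $3$: $f_1b_3,\ f_2b_4,\ f_3b_1,\ f_4b_2$; color $4$: $f_1b_4,\ f_2b_3,\ f_3b_2,\ f_4b_1$. -}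

module Defs where

open import Data.Fin using (Fin; zero; suc)
open import Data.Fin.Permutation using (Permutation′; _⟨$⟩ʳ_)
open import Data.Product using (_×_; ∃; Σ; ∃-syntax)
open import Relation.Binary.PropositionalEquality using (_≡_)
open import Relation.Nullary using (¬_)
open import Function.Bundles using (_⇔_)

-- Bosons b₁..b₄ ↔ Fin 4 (index i ↔ b_{i+1}), fermions f₁..f₄ ↔ Fin 4,
-- colors 1..4 ↔ Fin 4 (index c ↔ color c+1).
Boson Fermion Color : Set
Boson = Fin 4
Fermion = Fin 4
Color = Fin 4

-- An edge-colouring of the complete bipartite graph K_{4,4}:
-- col b f is the colour of the edge b f.
Coloring : Set
Coloring = Boson → Fermion → Color

BosonRegular : Coloring → Set
BosonRegular col = ∀ (b : Boson) (c : Color) →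
  ∃[ f ] (col b f ≡ c × (∀ f′ → col b f′ ≡ c → f′ ≡ f))

FermionRegular : Coloring → Set
FermionRegular col = ∀ (f : Fermion) (c : Color) →
  ∃[ b ] (col b f ≡ c × (∀ b′ → col b′ f ≡ c → b′ ≡ b))

InCD : Coloring → Color → Color → Boson → Fermion → Set
InCD col c d b f = (col b f ≡ c) Data.Sum.⊎ (col b f ≡ d)
  where import Data.Sum

FourCycle : Coloring → Color → Color → Boson → Fermion → Boson → Fermion → Set
FourCycle col c d b f₁ b₂ f₂ =
  ¬ b ≡ b₂ × ¬ f₁ ≡ f₂ ×
  InCD col c d b f₁ × InCD col c d b₂ f₁ × InCD col c d b₂ f₂ × InCD col c d b f₂

-- Given regularity, the (c,d)-subgraph is 2-regular, so it is a disjoint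
-- union of 4-cycles iff every vertex lies on a 4-cycle of that subgraph.
TwoColorFourCycles : Coloring → Set
TwoColorFourCycles col = ∀ (c d : Color) → ¬ c ≡ d →
  (∀ b → ∃[ f₁ ] ∃[ b₂ ] ∃[ f₂ ] FourCycle col c d b f₁ b₂ f₂) ×
  (∀ f → ∃[ b ] ∃[ f₁ ] ∃[ b₂ ] FourCycle col c d b f₁ b₂ f)

record IsChromotopology (col : Coloring) : Set where
  field
    bosonRegular   : BosonRegular col
    fermionRegular : FermionRegular col
    fourCycles     : TwoColorFourCycles col

pattern c1 = zero
pattern c2 = suc zero
pattern c3 = suc (suc zero)
pattern c4 = suc (suc (suc zero))

-- The standard chromotopology C⁰ (index 0..3 for b₁..b₄, f₁..f₄, colours 1..4).
-- colour 1: bᵢfᵢ; colour 2: f₁b₂, f₂b₁, f₃b₄, f₄b₃;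
-- colour 3: f₁b₃, f₂b₄, f₃b₁, f₄b₂; colour 4: f₁b₄, f₂b₃, f₃b₂, f₄b₁.
C⁰ : Coloring
C⁰ c1 c1 = c1
C⁰ c1 c2 = c2
C⁰ c1 c3 = c3
C⁰ c1 c4 = c4
C⁰ c2 c1 = c2
C⁰ c2 c2 = c1
C⁰ c2 c3 = c4
C⁰ c2 c4 = c3
C⁰ c3 c1 = c3
C⁰ c3 c2 = c4
C⁰ c3 c3 = c1
C⁰ c3 c4 = c2
C⁰ c4 c1 = c4
C⁰ c4 c2 = c3
C⁰ c4 c3 = c2
C⁰ c4 c4 = c1

Relabels : Coloring → Permutation′ 4 → Permutation′ 4 → Set
Relabels col ρB ρF = ∀ (c : Color) (i j : Fin 4) →
  (col (ρB ⟨$⟩ʳ i) (ρF ⟨$⟩ʳ j) ≡ c) ⇔ (C⁰ i j ≡ c)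

Good : Coloring → Permutation′ 4 → Permutation′ 4 → Set
Good col ρB ρF = (ρF ⟨$⟩ʳ zero ≡ zero) × Relabels col ρB ρF

_≈ₚ_ : Permutation′ 4 → Permutation′ 4 → Set
σ ≈ₚ τ = ∀ i → σ ⟨$⟩ʳ i ≡ τ ⟨$⟩ʳ i

{-# OPTIONS --safe #-}
module Submission where

-- Let ρB(i) be the boson joined to f₁ by colour i and ρF(j) the fermion joined
-- to ρB(1) by colour j.  By regularity L(i,j) = C(b_ρB(i), f_ρF(j)) is a Latin
-- square with identity first row and column.  For k ≠ 1 the {1,k}-coloured
-- 4-cycle through ρB(1) must be ρB(1) f₁ ρB(k) ρF(k), so L(k,k) = 1.  A reduced
-- Latin square of order 4 with constant diagonal is the Klein four-group table,
-- i.e. C⁰.  Conversely, any admissible pair has to send i to the colour-i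
-- neighbour of f₁ and j to the colour-j neighbour of ρB(1).

open import Defs
open import Data.Fin using (Fin; zero; _≟_)
open import Data.Fin.Permutation using (Permutation′; permutation; _⟨$⟩ʳ_; inverseˡ; inverseʳ)
open import Data.Fin.Properties using (all?)
open import Data.Nat using (ℕ; suc)
open import Data.Product using (_×_; ∃-syntax; _,_; proj₁; proj₂)
open import Data.Sum using (_⊎_; inj₁; inj₂; swap)
open import Function using (_∘_)
open import Function.Bundles using (Injection; Equivalence; mk⇔)
open import Function.Definitions using (Injective)
open import Function.Properties.Inverse using (↔⇒↣)
open import Relation.Nullary using (¬_; yes; no)
open import Relation.Nullary.Decidable using (from-yes; ¬?; _→-dec_)
open import Relation.Nullary.Negation using (contradiction)
open import Relation.Binary.PropositionalEquality
  using (_≡_; _≢_; refl; sym; trans; cong; cong₂; subst; module ≡-Reasoning)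

⊎-resolveˡ : ∀ {a b} {A : Set a} {B : Set b} → A ⊎ B → ¬ A → B
⊎-resolveˡ (inj₁ a) ¬a = contradiction a ¬a
⊎-resolveˡ (inj₂ b) _  = b

⟨$⟩ʳ-injective : ∀ {n} (π : Permutation′ n) → Injective _≡_ _≡_ (π ⟨$⟩ʳ_)
⟨$⟩ʳ-injective π = Injection.injective (↔⇒↣ π)

C⁰-identityˡ : ∀ j → C⁰ zero j ≡ j
C⁰-identityˡ = from-yes (all? λ j → C⁰ zero j ≟ j)

C⁰-identityʳ : ∀ i → C⁰ i zero ≡ i
C⁰-identityʳ = from-yes (all? λ i → C⁰ i zero ≟ i)

C⁰-diagonal : ∀ k → C⁰ k k ≡ zero
C⁰-diagonal = from-yes (all? λ k → C⁰ k k ≟ zero)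

≢0-i-j⇒≡C⁰ : ∀ i j x → i ≢ zero → j ≢ zero → i ≢ j →
  x ≢ zero → x ≢ i → x ≢ j → x ≡ C⁰ i j
≢0-i-j⇒≡C⁰ = from-yes (all? λ i → all? λ j → all? λ x →
  ¬? (i ≟ zero) →-dec ¬? (j ≟ zero) →-dec ¬? (i ≟ j) →-dec
  ¬? (x ≟ zero) →-dec ¬? (x ≟ i) →-dec ¬? (x ≟ j) →-dec x ≟ C⁰ i j)

record IsReducedLatinSquare {n : ℕ} (L : Fin (suc n) → Fin (suc n) → Fin (suc n)) : Set where
  field
    row-injective    : ∀ i → Injective _≡_ _≡_ (L i)
    column-injective : ∀ j → Injective _≡_ _≡_ (λ i → L i j)
    first-column     : ∀ i → L i zero ≡ i
    first-row        : ∀ j → L zero j ≡ j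

module _ {L : Fin 4 → Fin 4 → Fin 4} (latin : IsReducedLatinSquare L) where
  open IsReducedLatinSquare latin

  reducedLatinSquare-zeroDiagonal⇒C⁰ : (∀ k → k ≢ zero → L k k ≡ zero) → ∀ i j → L i j ≡ C⁰ i j
  reducedLatinSquare-zeroDiagonal⇒C⁰ diagonal i j with i ≟ zero | j ≟ zero | i ≟ j
  ... | yes refl | _        | _        = trans (first-row j) (sym (C⁰-identityˡ j))
  ... | no _     | yes refl | _        = trans (first-column i) (sym (C⁰-identityʳ i))
  ... | no i≢0   | no _     | yes refl = trans (diagonal i i≢0) (sym (C⁰-diagonal i))
  ... | no i≢0   | no j≢0   | no i≢j   = ≢0-i-j⇒≡C⁰ i j (L i j) i≢0 j≢0 i≢j Lij≢0 Lij≢i Lij≢j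
    where
      Lij≢0 : L i j ≢ zero
      Lij≢0 e = i≢j (sym (row-injective i (trans e (sym (diagonal i i≢0)))))
      Lij≢i : L i j ≢ i
      Lij≢i e = j≢0 (row-injective i (trans e (sym (first-column i))))
      Lij≢j : L i j ≢ j
      Lij≢j e = i≢0 (column-injective j (trans e (sym (first-row j))))

_ᵀ : Coloring → Coloring
(col ᵀ) f b = col b f

pointwise⇒Relabels : ∀ col ρB ρF →
  (∀ i j → col (ρB ⟨$⟩ʳ i) (ρF ⟨$⟩ʳ j) ≡ C⁰ i j) → Relabels col ρB ρF
pointwise⇒Relabels col ρB ρF entry c i j = mk⇔ (trans (sym (entry i j))) (trans (entry i j))

Relabels⇒pointwise : ∀ col ρB ρF → Relabels col ρB ρF →
  ∀ i j → col (ρB ⟨$⟩ʳ i) (ρF ⟨$⟩ʳ j) ≡ C⁰ i j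
Relabels⇒pointwise col ρB ρF relabels i j = Equivalence.from (relabels (C⁰ i j) i j) refl

module BosonRegularColouring {col : Coloring} (regular : BosonRegular col) where

  fermionsAt : Boson → Permutation′ 4
  fermionsAt b = permutation (λ c → proj₁ (regular b c)) (col b)
    (λ f → sym (proj₂ (proj₂ (regular b (col b f))) f refl))
    (λ c → proj₁ (proj₂ (regular b c)))

  fermionsAt-colour : ∀ b c → col b (fermionsAt b ⟨$⟩ʳ c) ≡ c
  fermionsAt-colour b c = inverseˡ (fermionsAt b)

  fermionsAt-unique : ∀ {b f c} → col b f ≡ c → f ≡ fermionsAt b ⟨$⟩ʳ c
  fermionsAt-unique {b} refl = sym (inverseʳ (fermionsAt b))

  row-injective : ∀ b → Injective _≡_ _≡_ (col b)
  row-injective b e = trans (fermionsAt-unique e) (sym (fermionsAt-unique refl))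

module RegularColouring {col : Coloring}
  (bosonRegular : BosonRegular col) (fermionRegular : FermionRegular col) where

  open BosonRegularColouring bosonRegular public
  -- FermionRegular col is definitionally BosonRegular (col ᵀ).
  open BosonRegularColouring {col ᵀ} fermionRegular public
    renaming ( fermionsAt to bosonsAt; fermionsAt-colour to bosonsAt-colour
             ; fermionsAt-unique to bosonsAt-unique; row-injective to column-injective)

  FourCycle-reverse : ∀ {c d b f₁ b₂ f₂} →
    FourCycle col c d b f₁ b₂ f₂ → FourCycle col c d b f₂ b₂ f₁
  FourCycle-reverse (b≢b₂ , f₁≢f₂ , e₁ , e₂ , e₃ , e₄) = b≢b₂ , f₁≢f₂ ∘ sym , e₄ , e₃ , e₂ , e₁

  FourCycle-alternates : ∀ {c d b f₁ b₂ f₂} → FourCycle col c d b f₁ b₂ f₂ →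
    col b f₁ ≡ c → col b₂ f₁ ≡ d × col b₂ f₂ ≡ c × col b f₂ ≡ d
  FourCycle-alternates {c} {d} {b} {f₁} {b₂} {f₂} (b≢b₂ , f₁≢f₂ , _ , e₂ , e₃ , e₄) bf₁≡c =
    b₂f₁≡d , b₂f₂≡c , bf₂≡d
    where
      b₂f₁≡d : col b₂ f₁ ≡ d
      b₂f₁≡d = ⊎-resolveˡ e₂ λ b₂f₁≡c → b≢b₂ (column-injective f₁ (trans bf₁≡c (sym b₂f₁≡c)))
      bf₂≡d : col b f₂ ≡ d
      bf₂≡d = ⊎-resolveˡ e₄ λ bf₂≡c → f₁≢f₂ (row-injective b (trans bf₁≡c (sym bf₂≡c)))
      b₂f₂≡c : col b₂ f₂ ≡ c
      b₂f₂≡c = ⊎-resolveˡ (swap e₃) λ b₂f₂≡d → b≢b₂ (column-injective f₂ (trans bf₂≡d (sym b₂f₂≡d)))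

  alternatingFourCycle : TwoColorFourCycles col → ∀ {c d} → c ≢ d → ∀ b →
    ∃[ f₁ ] ∃[ b₂ ] ∃[ f₂ ] (col b f₁ ≡ c × col b₂ f₁ ≡ d × col b₂ f₂ ≡ c × col b f₂ ≡ d)
  alternatingFourCycle cycles {c} {d} c≢d b with proj₁ (cycles c d c≢d) b
  ... | f₁ , b₂ , f₂ , cycle@(_ , f₁≢f₂ , bf₁ , _ , _ , bf₂) with bf₁
  ...   | inj₁ bf₁≡c = f₁ , b₂ , f₂ , bf₁≡c , FourCycle-alternates cycle bf₁≡c
  ...   | inj₂ bf₁≡d = f₂ , b₂ , f₁ , bf₂≡c , FourCycle-alternates (FourCycle-reverse cycle) bf₂≡c
    where
      bf₂≡c : col b f₂ ≡ c
      bf₂≡c = ⊎-resolveˡ (swap bf₂) λ bf₂≡d → f₁≢f₂ (row-injective b (trans bf₁≡d (sym bf₂≡d)))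

  ρB : Permutation′ 4
  ρB = bosonsAt zero

  b₀ : Boson
  b₀ = ρB ⟨$⟩ʳ zero

  ρF : Permutation′ 4
  ρF = fermionsAt b₀

  ρF-zero : ρF ⟨$⟩ʳ zero ≡ zero
  ρF-zero = sym (fermionsAt-unique (bosonsAt-colour zero zero))

  relabelled-isReducedLatinSquare : IsReducedLatinSquare (λ i j → col (ρB ⟨$⟩ʳ i) (ρF ⟨$⟩ʳ j))
  relabelled-isReducedLatinSquare = record
    { row-injective    = λ i → ⟨$⟩ʳ-injective ρF ∘ row-injective (ρB ⟨$⟩ʳ i)
    ; column-injective = λ j → ⟨$⟩ʳ-injective ρB ∘ column-injective (ρF ⟨$⟩ʳ j)
    ; first-column     = λ i → subst (λ f → col (ρB ⟨$⟩ʳ i) f ≡ i) (sym ρF-zero) (bosonsAt-colour zero i)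
    ; first-row        = fermionsAt-colour b₀
    }

  relabelled-diagonal : TwoColorFourCycles col → ∀ k → k ≢ zero → col (ρB ⟨$⟩ʳ k) (ρF ⟨$⟩ʳ k) ≡ zero
  relabelled-diagonal cycles k k≢0 with alternatingFourCycle cycles (k≢0 ∘ sym) b₀
  ... | f₁ , b₂ , f₂ , b₀f₁≡0 , b₂f₁≡k , b₂f₂≡0 , b₀f₂≡k = begin
    col (ρB ⟨$⟩ʳ k) (ρF ⟨$⟩ʳ k) ≡⟨ cong₂ col (sym b₂≡ρBk) (sym (fermionsAt-unique b₀f₂≡k)) ⟩
    col b₂ f₂                   ≡⟨ b₂f₂≡0 ⟩
    zero                        ∎
    where
      open ≡-Reasoning
      f₁≡0 : f₁ ≡ zero
      f₁≡0 = trans (fermionsAt-unique b₀f₁≡0) ρF-zero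
      b₂≡ρBk : b₂ ≡ ρB ⟨$⟩ʳ k
      b₂≡ρBk = bosonsAt-unique (subst (λ f → col b₂ f ≡ k) f₁≡0 b₂f₁≡k)

  Good-unique : ∀ σB σF → Good col σB σF → (σB ≈ₚ ρB) × (σF ≈ₚ ρF)
  Good-unique σB σF (σF-zero , relabels) = σB≈ρB , σF≈ρF
    where
      open ≡-Reasoning
      entry : ∀ i j → col (σB ⟨$⟩ʳ i) (σF ⟨$⟩ʳ j) ≡ C⁰ i j
      entry = Relabels⇒pointwise col σB σF relabels
      σB≈ρB : σB ≈ₚ ρB
      σB≈ρB i = bosonsAt-unique (begin
        col (σB ⟨$⟩ʳ i) zero           ≡⟨ cong (col (σB ⟨$⟩ʳ i)) (sym σF-zero) ⟩
        col (σB ⟨$⟩ʳ i) (σF ⟨$⟩ʳ zero) ≡⟨ entry i zero ⟩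
        C⁰ i zero                      ≡⟨ C⁰-identityʳ i ⟩
        i                              ∎)
      σF≈ρF : σF ≈ₚ ρF
      σF≈ρF j = fermionsAt-unique (begin
        col b₀ (σF ⟨$⟩ʳ j)             ≡⟨ cong (λ b → col b (σF ⟨$⟩ʳ j)) (sym (σB≈ρB zero)) ⟩
        col (σB ⟨$⟩ʳ zero) (σF ⟨$⟩ʳ j) ≡⟨ entry zero j ⟩
        C⁰ zero j                      ≡⟨ C⁰-identityˡ j ⟩
        j                              ∎)

lemma3p1 : (col : Coloring) → IsChromotopology col →
    ∃[ ρB ] ∃[ ρF ] (Good col ρB ρF ×
    (∀ (σB σF : Permutation′ 4) → Good col σB σF → (σB ≈ₚ ρB) × (σF ≈ₚ ρF)))
lemma3p1 col chromotopology =
  ρB , ρF , (ρF-zero , pointwise⇒Relabels col ρB ρF relabelled≡C⁰) , Good-unique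
  where
    open IsChromotopology chromotopology
    open RegularColouring bosonRegular fermionRegular
    relabelled≡C⁰ : ∀ i j → col (ρB ⟨$⟩ʳ i) (ρF ⟨$⟩ʳ j) ≡ C⁰ i j
    relabelled≡C⁰ = reducedLatinSquare-zeroDiagonal⇒C⁰
      relabelled-isReducedLatinSquare (relabelled-diagonal fourCycles)
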